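{- Let $N \geq 0$ be an integer and $r \in \mathbb{C}$. Then, in $\mathbb{C}\{[\ell]\}[[y]]$, \[ e^{y\frac{d}{dx}}\big(\ell_{N}(x)^{r}\big)=\sum_{m \geq 0}\frac{y^{m}}{m!}\sum_{\substack{j_{0}+j_{1}+\cdots+j_{N}=m\\ j_0,\dots,j_N\ge 0}} j_{N}!\binom{r}{j_{N}}(-1)^{\alpha_{0}-\alpha_{N}}\left(\prod_{i=0}^{N-1}\begin{bmatrix}\alpha_{i}\\ \alpha_{i+1}\end{bmatrix}\right)\ell_{N}(x)^{r}\prod_{i=0}^{N}\ell_{i}(x)^{ -\alpha_{i}}, \] where $\alpha_{i}=j_{i}+j_{i+1}+\cdots+j_{N}$ for $0\le i\le N$. (The left side is denoted $\ell_N(x+y)^r$ in the paper.)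
   Context: Let $\ell_{n}(x)$, $n \in \mathbb{Z}$, be commuting formal variables and let $\mathbb{C}\{[\ell]\}$ be the commutative algebra with vector space basis all monomials $\prod_{i \in \mathbb{Z}}\ell_{i}(x)^{r_{i}}$ with $r_i\in\mathbb{C}$ and all but finitely many $r_i=0$, multiplication given by adding exponents. Let $\frac{d}{dx}$ be the unique derivation of $\mathbb{C}\{[\ell]\}$ with $\frac{d}{dx}\ell_{0}(x)^{r}=r\ell_{0}(x)^{r-1}$, and for $n>0$, $r\in\mathbb{C}$: $\frac{d}{dx}\ell_{n}(x)^{r}=r\ell_{n}(x)^{r-1}\prod_{i=0}^{n-1}\ell_{i}(x)^{ -1}$ and $\frac{d}{dx}\ell_{ -n}(x)^{r}=r\ell_{ -n}(x)^{r-1}\prod_{i=1}^{n}\ell_{ -i}(x)$. For a formal variable $y$, $e^{y\frac{d}{dx}}=\sum_{k\ge0}\frac{y^k}{k!}\left(\frac{d}{dx}\right)^k$. For $r\in\mathbb{C}$, $\binom{r}{m}=r(r-1)\cdots(r-m+1)/m!$. The (signless) Stirling numbers of the first kind are $\begin{bmatrix}m\\ n\end{bmatrix}=\sum_{0 \leq t_{1} < t_{2} < \cdots < t_{m-n}< m}t_{1} \cdots t_{m-n}$ for $0\le n\le m$ (empty product $=1$), with $\begin{bmatrix}0\\0\end{bmatrix}=1$ and $\begin{bmatrix}m\\0\end{bmatrix}=0$ for $m\ge1$. -}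

module Defs where

open import Level using (_⊔_)
open import Algebra.Bundles using (CommutativeRing; Semiring)
open import Data.Nat as ℕ using (ℕ; zero; suc; _∸_; _≤ᵇ_; _!)
open import Data.Integer as ℤ using (ℤ; +_; -[1+_])
open import Data.List as L using (List; []; _∷_; _++_; map; concatMap; upTo; zipWith)
import Data.Nat.ListAction as NL
open import Data.Vec as V using (Vec)
open import Data.Product using (_×_; _,_)
open import Data.Bool using (if_then_else_)
open import Relation.Nullary.Decidable using (⌊_⌋)

-- Signless Stirling numbers of the first kind, defined exactly as in the paper:
-- [m n] = sum over 0 ≤ t₁ < … < t_{m-n} < m of t₁⋯t_{m-n}  (for n ≤ m; 0 otherwise, never used)
subsetsOfSize : ℕ → List ℕ → List (List ℕ)
subsetsOfSize zero    _        = [] ∷ []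
subsetsOfSize (suc k) []       = []
subsetsOfSize (suc k) (x ∷ xs) = map (x ∷_) (subsetsOfSize k xs) ++ subsetsOfSize (suc k) xs

stirling1 : ℕ → ℕ → ℕ
stirling1 m n = if n ≤ᵇ m then NL.sum (map NL.product (subsetsOfSize (m ∸ n) (upTo m))) else 0

compositions : ℕ → (n : ℕ) → List (Vec ℕ (suc n))
compositions m zero    = (m V.∷ V.[]) ∷ []
compositions m (suc n) = concatMap (λ j₀ → map (j₀ V.∷_) (compositions (m ∸ j₀) n)) (upTo (suc m))

tailSums : ∀ {k} → Vec ℕ k → Vec ℕ k
tailSums V.[]       = V.[]
tailSums (j V.∷ js) = (j ℕ.+ V.sum js) V.∷ tailSums js

-- Everything over a commutative ring R in which all factorials m! are invertible
-- (inv! m is meant to be (m!)⁻¹); ℂ is the case of the paper.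
module Setup {c ℓ} (R : CommutativeRing c ℓ) (inv! : ℕ → CommutativeRing.Carrier R) where
  open CommutativeRing R renaming (Carrier to A)
  open import Algebra.Definitions.RawSemiring (Semiring.rawSemiring semiring) using () renaming (_×_ to _·ℕ_; _^_ to _^ℕ_)

  fromℕ : ℕ → A
  fromℕ n = n ·ℕ 1#

  -- a monomial ∏ ℓᵢ^{rᵢ}, given as a finite list of factors (i , rᵢ)
  Mono : Set c
  Mono = List (ℤ × A)

  expo : Mono → ℤ → A
  expo []            n = 0#
  expo ((i , a) ∷ m) n = if ⌊ i ℤ.≟ n ⌋ then a + expo m n else expo m n

  _≈ₘ_ : Mono → Mono → Set ℓ
  m ≈ₘ m' = ∀ n → expo m n ≈ expo m' n

  -- elements of ℂ{[ℓ]}: finite formal linear combinations of monomials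
  Elem : Set c
  Elem = List (A × Mono)

  -- equality in ℂ{[ℓ]} (the free R-module on the monomials):
  -- the congruence generated by reordering, merging equal monomials,
  -- dropping zero terms, and equality of coefficients/monomials
  infix 4 _∼_
  data _∼_ : Elem → Elem → Set (c ⊔ ℓ) where
    ∼-refl  : ∀ {s} → s ∼ s
    ∼-sym   : ∀ {s t} → s ∼ t → t ∼ s
    ∼-trans : ∀ {s t u} → s ∼ t → t ∼ u → s ∼ u
    ∼-cons  : ∀ x {s t} → s ∼ t → x ∷ s ∼ x ∷ t
    ∼-swap  : ∀ x y t → x ∷ y ∷ t ∼ y ∷ x ∷ t
    ∼-merge : ∀ {a b m m'} t → m ≈ₘ m' → (a , m) ∷ (b , m') ∷ t ∼ (a + b , m) ∷ t
    ∼-zero  : ∀ {a} m t → a ≈ 0# → (a , m) ∷ t ∼ t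
    ∼-coeff : ∀ {a b} m t → a ≈ b → (a , m) ∷ t ∼ (b , m) ∷ t
    ∼-mono  : ∀ a {m m'} t → m ≈ₘ m' → (a , m) ∷ t ∼ (a , m') ∷ t

  infixr 7 _•_
  _•_ : A → Elem → Elem
  a • f = map (λ { (b , m) → (a * b , m) }) f

  ℓpow : ℤ → A → Elem
  ℓpow i r = (1# , (i , r) ∷ []) ∷ []

  -- the extra factor in d/dx ℓᵢ^r = r ℓᵢ^{r-1} · cfactor i :
  -- i = 0 : 1 ;  i = n > 0 : ∏_{k=0}^{n-1} ℓₖ⁻¹ ;  i = -n < 0 : ∏_{k=1}^{n} ℓ₋ₖ
  cfactor : ℤ → Mono
  cfactor (+ zero)  = []
  cfactor (+ suc n) = map (λ k → (+ k , - 1#)) (upTo (suc n))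
  cfactor -[1+ n ]  = map (λ k → (-[1+ k ] , 1#)) (upTo (suc n))

  -- the derivation d/dx on a monomial (Leibniz rule over its factors)
  dMono : Mono → Elem
  dMono m = map (λ { (i , a) → (a , (i , - 1#) ∷ cfactor i ++ m) }) m

  d : Elem → Elem
  d f = concatMap (λ { (a , m) → a • dMono m }) f

  dIter : ℕ → Elem → Elem
  dIter zero    f = f
  dIter (suc k) f = d (dIter k f)

  -- e^{y d/dx} f ∈ ℂ{[ℓ]}[[y]], as its sequence of coefficients of yᵏ: (1/k!) (d/dx)ᵏ f
  expYD : Elem → ℕ → Elem
  expYD f k = inv! k • dIter k f

  falling : A → ℕ → A
  falling r zero    = 1#
  falling r (suc j) = falling r j * (r - fromℕ j)

  binom : A → ℕ → A
  binom r j = falling r j * inv! j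

  stirProd : List ℕ → A
  stirProd (a ∷ b ∷ t) = fromℕ (stirling1 a b) * stirProd (b ∷ t)
  stirProd _           = 1#

  term : (N : ℕ) → A → Vec ℕ (suc N) → Elem
  term N r js =
    let αs = tailSums js
        jN = V.last js
        coef = fromℕ (jN !) * binom r jN * ((- 1#) ^ℕ (V.head αs ∸ V.last αs)) * stirProd (V.toList αs)
        mono = (+ N , r) ∷ zipWith (λ i α → (+ i , - fromℕ α)) (upTo (suc N)) (V.toList αs)
    in (coef , mono) ∷ []

  rhs : (N : ℕ) → A → ℕ → Elem
  rhs N r m = inv! m • concatMap (term N r) (compositions m N)

-- Write α₀ ≥ … ≥ α_N for the tail sums of a composition j = (j₀, …, j_N) and c(j) for the
-- coefficient of ℓ_N^r ∏ ℓᵢ^{−αᵢ} in the claim, and induct on m. Differentiating the factor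
-- ℓᵢ^e of a monomial multiplies it by e ℓ₀⁻¹⋯ℓᵢ⁻¹, which turns the monomial of j into that
-- of j + eᵢ, with e = δᵢN r − αᵢ(j). Collecting equal monomials, the induction step is the
-- coefficient recurrence
--   c(k) = Σ_{i : kᵢ > 0} c(k − eᵢ) (δᵢN r − αᵢ(k − eᵢ)).
-- For i = N the weight r − (k_N − 1) extends the falling factorial r(r − 1)⋯ in c; for i < N
-- it is −(αᵢ(k) − 1), whose sign is absorbed by (−1)^{α₀ − α_N}. What remains is an identity
-- for the products ∏ [αᵢ, αᵢ₊₁] of Stirling numbers, proved by peeling off the first factor
-- with [a + 1, b + 1] = a [a, b + 1] + [a, b].
-- As elements of ℂ{[ℓ]} are lists of terms up to the congruence ∼, collecting is done via a
-- normal form: two lists of keyed terms with the same total coefficient at every key are ∼.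

module Submission where

open import Defs
open import Algebra.Bundles using (CommutativeRing; Semiring)
open import Data.Nat using (ℕ; _!)
open import Data.Integer using (+_)

import Algebra.Properties.Ring as RingProperties
import Algebra.Solver.CommutativeMonoid as CommutativeMonoidSolver
open import Data.Bool using (Bool; true; false; if_then_else_; _∧_; T)
open import Data.Empty using (⊥-elim)
import Data.Integer as ℤ
open import Data.Integer using (ℤ; -[1+_])
import Data.Integer.Properties as ℤₚ
open import Data.List using (List; []; _∷_; _++_; map; concatMap; upTo; zipWith; applyUpTo; length; replicate; deduplicate)
import Data.List.Properties as List
open import Data.List.Membership.Propositional using (_∈_)
open import Data.List.Membership.Propositional.Properties using (∈-map⁺; ∈-++⁺ˡ; ∈-++⁺ʳ; ∈-deduplicate⁺)
open import Data.List.Relation.Binary.Permutation.Propositional as ↭ using (_↭_)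
import Data.List.Relation.Binary.Permutation.Propositional.Properties as ↭ₚ
open import Data.List.Relation.Unary.All as All using (All; []; _∷_)
open import Data.List.Relation.Unary.Any using (here; there)
open import Data.List.Relation.Unary.Unique.Propositional using (Unique; []; _∷_)
import Data.List.Relation.Unary.Unique.DecPropositional.Properties as Unique
open import Data.Maybe using (nothing)
open import Data.Nat using (zero; suc)
import Data.Nat as ℕ
import Data.Nat.ListAction as ListAction
import Data.Nat.ListAction.Properties as ListAction
import Data.Nat.Properties as ℕₚ
open import Data.Nat.Solver using (module +-*-Solver)
open import Data.Product using (_×_; _,_; proj₁; proj₂; map₂; swap)
open import Data.Sum using (inj₁; inj₂)
open import Data.Unit using (tt)
open import Data.Vec as Vec using (Vec)
open import Data.Vec.Properties using (≡-dec)
open import Function using (_∘′_)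
open import Relation.Binary.Definitions using (DecidableEquality; Tri; tri<; tri≈; tri>)
open import Relation.Binary.PropositionalEquality as ≡ using (_≡_; _≢_; refl)
open import Relation.Nullary.Decidable using (does; yes; no; dec-true; dec-false; isYes≗does)
open import Tactic.RingSolver.Core.AlmostCommutativeRing using (fromCommutativeRing)

module BooleanTests where
  open import Data.Nat
  open import Data.Nat.Properties
  open ≡

  ≤⇒≤ᵇ≡true : ∀ {m n} → m ≤ n → (m ≤ᵇ n) ≡ true
  ≤⇒≤ᵇ≡true = dec-true (_ ≤? _)

  >⇒≤ᵇ≡false : ∀ {m n} → n < m → (m ≤ᵇ n) ≡ false
  >⇒≤ᵇ≡false n<m = dec-false (_ ≤? _) (<⇒≱ n<m)

  <⇒<ᵇ≡true : ∀ {m n} → m < n → (m <ᵇ n) ≡ true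
  <⇒<ᵇ≡true = dec-true (_ <? _)

  ≥⇒<ᵇ≡false : ∀ {m n} → n ≤ m → (m <ᵇ n) ≡ false
  ≥⇒<ᵇ≡false n≤m = dec-false (_ <? _) (≤⇒≯ n≤m)

  ≡ᵇ-refl : ∀ n → (n ≡ᵇ n) ≡ true
  ≡ᵇ-refl n = dec-true (n ≟ n) refl

  ≢⇒≡ᵇ≡false : ∀ {m n} → m ≢ n → (m ≡ᵇ n) ≡ false
  ≢⇒≡ᵇ≡false = dec-false (_ ≟ _)

  ≡ᵇ-∸ : ∀ x m s → x ≤ m → (s ≡ᵇ (m ∸ x)) ≡ ((x + s) ≡ᵇ m)
  ≡ᵇ-∸ zero    m       s _       = refl
  ≡ᵇ-∸ (suc x) (suc m) s (s≤s p) = ≡ᵇ-∸ x m s p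

  ≡ᵇ≡true⇒≡ : ∀ {m n} → (m ≡ᵇ n) ≡ true → m ≡ n
  ≡ᵇ≡true⇒≡ {m} {n} e = ≡ᵇ⇒≡ m n (subst T (sym e) tt)

open BooleanTests

module StirlingNumbers where
  open import Data.Nat
  open import Data.Nat.Properties
  open ≡
  open +-*-Solver

  esym : ℕ → List ℕ → ℕ
  esym k xs = ListAction.sum (map ListAction.product (subsetsOfSize k xs))

  sum-product-map-∷ : ∀ y (xss : List (List ℕ)) →
    ListAction.sum (map ListAction.product (map (y ∷_) xss)) ≡ y * ListAction.sum (map ListAction.product xss)
  sum-product-map-∷ y []         = sym (*-zeroʳ y)
  sum-product-map-∷ y (xs ∷ xss) rewrite sum-product-map-∷ y xss = sym (*-distribˡ-+ y (ListAction.product xs) _)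

  esym-∷ : ∀ k y ys → esym (suc k) (y ∷ ys) ≡ y * esym k ys + esym (suc k) ys
  esym-∷ k y ys = begin
    ListAction.sum (map ListAction.product (map (y ∷_) (subsetsOfSize k ys) ++ subsetsOfSize (suc k) ys))
      ≡⟨ cong ListAction.sum (List.map-++ ListAction.product (map (y ∷_) (subsetsOfSize k ys)) _) ⟩
    ListAction.sum (map ListAction.product (map (y ∷_) (subsetsOfSize k ys)) ++ map ListAction.product (subsetsOfSize (suc k) ys))
      ≡⟨ ListAction.sum-++ (map ListAction.product (map (y ∷_) (subsetsOfSize k ys))) _ ⟩
    ListAction.sum (map ListAction.product (map (y ∷_) (subsetsOfSize k ys))) + esym (suc k) ys
      ≡⟨ cong (_+ esym (suc k) ys) (sum-product-map-∷ y (subsetsOfSize k ys)) ⟩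
    y * esym k ys + esym (suc k) ys ∎
    where open ≡-Reasoning

  esym-∷ʳ : ∀ k xs x → esym (suc k) (xs ++ x ∷ []) ≡ esym (suc k) xs + x * esym k xs
  esym-∷ʳ zero    []       x = solve 1 (λ x → x :* con 1 :+ con 0 := con 0 :+ x :* con 1) refl x
  esym-∷ʳ (suc k) []       x = sym (*-zeroʳ x)
  esym-∷ʳ zero    (y ∷ ys) x rewrite esym-∷ zero y (ys ++ x ∷ []) | esym-∷ʳ zero ys x | esym-∷ zero y ys =
    solve 3 (λ y a x → y :* con 1 :+ (a :+ x :* con 1) := y :* con 1 :+ a :+ x :* con 1) refl y (esym 1 ys) x
  esym-∷ʳ (suc k) (y ∷ ys) x
    rewrite esym-∷ (suc k) y (ys ++ x ∷ []) | esym-∷ʳ (suc k) ys x | esym-∷ʳ k ys x | esym-∷ (suc k) y ys | esym-∷ k y ys =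
    solve 5 (λ y a b c x → y :* (a :+ x :* b) :+ (c :+ x :* a) := y :* a :+ c :+ x :* (y :* b :+ a))
      refl y (esym (suc k) ys) (esym k ys) (esym (suc (suc k)) ys) x

  esym-short : ∀ k xs → length xs < k → esym k xs ≡ 0
  esym-short (suc k)       []       _       = refl
  esym-short (suc zero)    (y ∷ ys) (s≤s ())
  esym-short (suc (suc k)) (y ∷ ys) (s≤s p)
    rewrite esym-∷ (suc k) y ys | esym-short (suc k) ys p | esym-short (suc (suc k)) ys (m<n⇒m<1+n p) =
    trans (+-identityʳ _) (*-zeroʳ y)

  stirling1-esym : ∀ d j → stirling1 (d + j) j ≡ esym d (upTo (d + j))
  stirling1-esym d j rewrite ≤⇒≤ᵇ≡true (m≤n+m j d) | m+n∸n≡m d j = refl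

  stirling1-> : ∀ {m n} → m < n → stirling1 m n ≡ 0
  stirling1-> m<n rewrite >⇒≤ᵇ≡false m<n = refl

  stirling1-diag : ∀ n → stirling1 n n ≡ 1
  stirling1-diag n = stirling1-esym 0 n

  stirling1-suc-zero : ∀ n → stirling1 (suc n) 0 ≡ 0
  stirling1-suc-zero n
    rewrite esym-∷ n 0 (applyUpTo suc n)
          | esym-short (suc n) (applyUpTo suc n) (≤-reflexive (cong suc (List.length-applyUpTo suc n))) = refl

  stirling1-suc-suc-< : ∀ t j → let n = t + suc j in
    stirling1 (suc n) (suc j) ≡ n * stirling1 n (suc j) + stirling1 n j
  stirling1-suc-suc-< t j = begin
    stirling1 (suc t + suc j) (suc j)          ≡⟨ stirling1-esym (suc t) (suc j) ⟩
    esym (suc t) (upTo (suc n))                ≡⟨ cong (esym (suc t)) (sym (List.upTo-∷ʳ n)) ⟩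
    esym (suc t) (upTo n ++ n ∷ [])            ≡⟨ esym-∷ʳ t (upTo n) n ⟩
    esym (suc t) (upTo n) + n * esym t (upTo n) ≡⟨ +-comm (esym (suc t) (upTo n)) _ ⟩
    n * esym t (upTo n) + esym (suc t) (upTo n) ≡⟨ cong₂ (λ a b → n * a + b) (sym (stirling1-esym t (suc j))) shift ⟩
    n * stirling1 n (suc j) + stirling1 n j    ∎
    where
    open ≡-Reasoning
    n = t + suc j
    shift : esym (suc t) (upTo n) ≡ stirling1 n j
    shift = begin
      esym (suc t) (upTo n)           ≡⟨ cong (esym (suc t) ∘′ upTo) (+-suc t j) ⟩
      esym (suc t) (upTo (suc t + j)) ≡⟨ sym (stirling1-esym (suc t) j) ⟩
      stirling1 (suc t + j) j         ≡⟨ cong (λ z → stirling1 z j) (sym (+-suc t j)) ⟩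
      stirling1 n j                   ∎

  stirling1-suc-suc : ∀ n j → stirling1 (suc n) (suc j) ≡ n * stirling1 n (suc j) + stirling1 n j
  stirling1-suc-suc n j with <-cmp j n
  ... | tri< j<n _ _ rewrite sym (m∸n+n≡m j<n) = stirling1-suc-suc-< (n ∸ suc j) j
  ... | tri≈ _ refl _ rewrite stirling1-diag (suc n) | stirling1-diag n | stirling1-> (n<1+n n) =
    sym (cong (_+ 1) (*-zeroʳ n))
  ... | tri> _ _ n<j rewrite stirling1-> (s≤s n<j) | stirling1-> (m<n⇒m<1+n n<j) | stirling1-> n<j =
    sym (trans (+-identityʳ _) (*-zeroʳ n))

module Compositions where
  open import Data.Nat
  open import Data.Nat.Properties
  open import Data.Bool.Properties using (∧-zeroʳ)
  open ≡

  entry : ∀ {n} → ℕ → Vec ℕ n → ℕ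
  entry _       Vec.[]       = 0
  entry zero    (x Vec.∷ v) = x
  entry (suc i) (x Vec.∷ v) = entry i v

  decrementAt : ∀ {n} → ℕ → Vec ℕ n → Vec ℕ n
  decrementAt _       Vec.[]       = Vec.[]
  decrementAt zero    (x Vec.∷ v) = (x ∸ 1) Vec.∷ v
  decrementAt (suc i) (x Vec.∷ v) = x Vec.∷ decrementAt i v

  incrementAt : ∀ {n} → ℕ → Vec ℕ n → Vec ℕ n
  incrementAt _       Vec.[]       = Vec.[]
  incrementAt zero    (x Vec.∷ v) = suc x Vec.∷ v
  incrementAt (suc i) (x Vec.∷ v) = x Vec.∷ incrementAt i v

  isPositive : ℕ → Bool
  isPositive zero    = false
  isPositive (suc _) = true

  sumExceptLast : ∀ {n} → Vec ℕ (suc n) → ℕ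
  sumExceptLast {zero}  (x Vec.∷ Vec.[]) = 0
  sumExceptLast {suc n} (x Vec.∷ w)      = x + sumExceptLast w

  entry-sum≡0 : ∀ {n} i (w : Vec ℕ n) → Vec.sum w ≡ 0 → entry i w ≡ 0
  entry-sum≡0 i       Vec.[]       _     = refl
  entry-sum≡0 zero    (x Vec.∷ w) sum≡0 = m+n≡0⇒m≡0 x sum≡0
  entry-sum≡0 (suc i) (x Vec.∷ w) sum≡0 = entry-sum≡0 i w (m+n≡0⇒n≡0 x sum≡0)

  sum-decrementAt : ∀ {n} i (w : Vec ℕ n) → isPositive (entry i w) ≡ true → suc (Vec.sum (decrementAt i w)) ≡ Vec.sum w
  sum-decrementAt zero    (suc x Vec.∷ w) _   = refl
  sum-decrementAt (suc i) (x Vec.∷ w)     pos = trans (sym (+-suc x _)) (cong (_+_ x) (sum-decrementAt i w pos))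

  indicator : Bool → ℕ
  indicator b = if b then 1 else 0

  sum-incrementAt : ∀ {n} i (j : Vec ℕ n) → i < n → Vec.sum (incrementAt i j) ≡ suc (Vec.sum j)
  sum-incrementAt zero    (x Vec.∷ v) _       = refl
  sum-incrementAt (suc i) (x Vec.∷ v) (s≤s p) = trans (cong (_+_ x) (sum-incrementAt i v p)) (+-suc x _)

  entry-tailSums-incrementAt : ∀ {n} i t (j : Vec ℕ n) → i < n →
    entry t (tailSums (incrementAt i j)) ≡ entry t (tailSums j) + indicator (t ≤ᵇ i)
  entry-tailSums-incrementAt zero    zero    (x Vec.∷ v) _       = +-comm 1 _
  entry-tailSums-incrementAt zero    (suc t) (x Vec.∷ v) _       = sym (+-identityʳ _)
  entry-tailSums-incrementAt (suc i) zero    (x Vec.∷ v) (s≤s p) =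
    trans (cong (_+_ x) (sum-incrementAt i v p)) (trans (+-suc x _) (+-comm 1 _))
  entry-tailSums-incrementAt (suc i) (suc t) (x Vec.∷ v) (s≤s p) =
    trans (entry-tailSums-incrementAt i t v p) (cong (λ b → _ + indicator b) (lemma t))
    where
    lemma : ∀ t → (t ≤ᵇ i) ≡ (t <ᵇ suc i)
    lemma zero    = refl
    lemma (suc t) = refl

  entry-≥ : ∀ {n} t (v : Vec ℕ n) → n ≤ t → entry t v ≡ 0
  entry-≥ t       Vec.[]       _       = refl
  entry-≥ (suc t) (x Vec.∷ v) (s≤s p) = entry-≥ t v p

  entry-tailSums-last : ∀ {n} (v : Vec ℕ (suc n)) → entry n (tailSums v) ≡ Vec.last v
  entry-tailSums-last {zero}  (x Vec.∷ Vec.[]) = +-identityʳ x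
  entry-tailSums-last {suc n} (x Vec.∷ w)      = entry-tailSums-last w

  head-tailSums : ∀ {n} (j : Vec ℕ (suc n)) → Vec.head (tailSums j) ≡ Vec.sum j
  head-tailSums (x Vec.∷ v) = refl

  last-tailSums : ∀ {n} (j : Vec ℕ (suc n)) → Vec.last (tailSums j) ≡ Vec.last j
  last-tailSums {zero}  (x Vec.∷ Vec.[]) = +-identityʳ x
  last-tailSums {suc n} (x Vec.∷ w)      = last-tailSums w

  sum≡sumExceptLast+last : ∀ {n} (j : Vec ℕ (suc n)) → Vec.sum j ≡ sumExceptLast j + Vec.last j
  sum≡sumExceptLast+last {zero}  (x Vec.∷ Vec.[]) = +-identityʳ x
  sum≡sumExceptLast+last {suc n} (x Vec.∷ w)      = trans (cong (_+_ x) (sum≡sumExceptLast+last w)) (sym (+-assoc x _ _))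

  head∸last-tailSums : ∀ {n} (j : Vec ℕ (suc n)) → Vec.head (tailSums j) ∸ Vec.last (tailSums j) ≡ sumExceptLast j
  head∸last-tailSums j rewrite head-tailSums j | last-tailSums j | sum≡sumExceptLast+last j = m+n∸n≡m (sumExceptLast j) (Vec.last j)

  last-decrementAt-< : ∀ {n} i (k : Vec ℕ (suc n)) → i < n → Vec.last (decrementAt i k) ≡ Vec.last k
  last-decrementAt-< zero    (x Vec.∷ y Vec.∷ v) _       = refl
  last-decrementAt-< (suc i) (x Vec.∷ y Vec.∷ v) (s≤s p) = last-decrementAt-< i (y Vec.∷ v) p

  sumExceptLast-decrementAt-< : ∀ {n} i (k : Vec ℕ (suc n)) → i < n → isPositive (entry i k) ≡ true →
    suc (sumExceptLast (decrementAt i k)) ≡ sumExceptLast k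
  sumExceptLast-decrementAt-< zero    (suc x Vec.∷ y Vec.∷ v) _       _   = refl
  sumExceptLast-decrementAt-< (suc i) (x Vec.∷ y Vec.∷ v)     (s≤s p) pos =
    trans (sym (+-suc x _)) (cong (_+_ x) (sumExceptLast-decrementAt-< i (y Vec.∷ v) p pos))

  suc-last-decrementAt-last : ∀ {n} (k : Vec ℕ (suc n)) → isPositive (entry n k) ≡ true → suc (Vec.last (decrementAt n k)) ≡ Vec.last k
  suc-last-decrementAt-last {zero}  (suc x Vec.∷ Vec.[]) _   = refl
  suc-last-decrementAt-last {suc n} (x Vec.∷ w)          pos = suc-last-decrementAt-last w pos

  sumExceptLast-decrementAt-last : ∀ {n} (k : Vec ℕ (suc n)) → sumExceptLast (decrementAt n k) ≡ sumExceptLast k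
  sumExceptLast-decrementAt-last {zero}  (x Vec.∷ Vec.[]) = refl
  sumExceptLast-decrementAt-last {suc n} (x Vec.∷ w)      = cong (_+_ x) (sumExceptLast-decrementAt-last w)

  infix 4 _≟ᵛ_
  _≟ᵛ_ : ∀ {n} → DecidableEquality (Vec ℕ n)
  _≟ᵛ_ = ≡-dec _≟_

  incrementAt-≟ᵛ : ∀ {n} i (j k : Vec ℕ n) → i < n →
    does (incrementAt i j ≟ᵛ k) ≡ isPositive (entry i k) ∧ does (j ≟ᵛ decrementAt i k)
  incrementAt-≟ᵛ zero    (x Vec.∷ v) (zero Vec.∷ w)  _ = refl
  incrementAt-≟ᵛ zero    (x Vec.∷ v) (suc y Vec.∷ w) _ = refl
  incrementAt-≟ᵛ (suc i) (x Vec.∷ v) (y Vec.∷ w) (s≤s p) rewrite incrementAt-≟ᵛ i v w p with x ≡ᵇ y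
  ... | true  = refl
  ... | false = sym (∧-zeroʳ (isPositive (entry i w)))

  sum-replicate-0 : ∀ n → Vec.sum (Vec.replicate n 0) ≡ 0
  sum-replicate-0 zero    = refl
  sum-replicate-0 (suc n) = sum-replicate-0 n

  compositions-0 : ∀ n → compositions 0 n ≡ Vec.replicate (suc n) 0 ∷ []
  compositions-0 zero    = refl
  compositions-0 (suc n) rewrite compositions-0 n = refl

  entry-tailSums-sum≡0 : ∀ {n} t (v : Vec ℕ n) → Vec.sum v ≡ 0 → entry t (tailSums v) ≡ 0
  entry-tailSums-sum≡0 t       Vec.[]       _     = refl
  entry-tailSums-sum≡0 zero    (x Vec.∷ v) sum≡0 = sum≡0
  entry-tailSums-sum≡0 (suc t) (x Vec.∷ v) sum≡0 = entry-tailSums-sum≡0 t v (m+n≡0⇒n≡0 x sum≡0)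

  last-replicate-0 : ∀ n → Vec.last (Vec.replicate (suc n) 0) ≡ 0
  last-replicate-0 zero    = refl
  last-replicate-0 (suc n) = last-replicate-0 n

  sumExceptLast-replicate-0 : ∀ n → sumExceptLast (Vec.replicate (suc n) 0) ≡ 0
  sumExceptLast-replicate-0 zero    = refl
  sumExceptLast-replicate-0 (suc n) = sumExceptLast-replicate-0 n

module StirlingChains where
  open import Data.Nat
  open import Data.Nat.Properties
  open ≡
  open +-*-Solver
  open StirlingNumbers
  open Compositions

  ∑ℕ : List ℕ → (ℕ → ℕ) → ℕ
  ∑ℕ []       f = 0
  ∑ℕ (x ∷ xs) f = f x + ∑ℕ xs f

  ∑ℕ-applyUpTo : ∀ f g n → ∑ℕ (applyUpTo g n) f ≡ ∑ℕ (upTo n) (λ i → f (g i))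
  ∑ℕ-applyUpTo f g zero    = refl
  ∑ℕ-applyUpTo f g (suc n) =
    cong (_+_ (f (g 0))) (trans (∑ℕ-applyUpTo f (g ∘′ suc) n) (sym (∑ℕ-applyUpTo (f ∘′ g) suc n)))

  ∑ℕ-cong : ∀ xs {f g} → (∀ i → f i ≡ g i) → ∑ℕ xs f ≡ ∑ℕ xs g
  ∑ℕ-cong []       f≗g = refl
  ∑ℕ-cong (x ∷ xs) f≗g = cong₂ _+_ (f≗g x) (∑ℕ-cong xs f≗g)

  ∑ℕ-*ˡ : ∀ c xs f → ∑ℕ xs (λ i → c * f i) ≡ c * ∑ℕ xs f
  ∑ℕ-*ˡ c []       f = sym (*-zeroʳ c)
  ∑ℕ-*ˡ c (x ∷ xs) f = trans (cong (_+_ (c * f x)) (∑ℕ-*ˡ c xs f)) (sym (*-distribˡ-+ c (f x) _))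

  ∑ℕ-zero : ∀ xs {f} → (∀ i → f i ≡ 0) → ∑ℕ xs f ≡ 0
  ∑ℕ-zero []       f≗0 = refl
  ∑ℕ-zero (x ∷ xs) f≗0 rewrite f≗0 x = ∑ℕ-zero xs f≗0

  stirlingChain : List ℕ → ℕ
  stirlingChain (a ∷ b ∷ t) = stirling1 a b * stirlingChain (b ∷ t)
  stirlingChain _           = 1

  tailChain : ∀ {n} → Vec ℕ n → ℕ
  tailChain j = stirlingChain (Vec.toList (tailSums j))

  tailChain-∷ : ∀ {n} x (w : Vec ℕ (suc n)) → tailChain (x Vec.∷ w) ≡ stirling1 (x + Vec.sum w) (Vec.sum w) * tailChain w
  tailChain-∷ x (y Vec.∷ v) = refl

  tailChain-sum≡0 : ∀ {n} (w : Vec ℕ (suc n)) → Vec.sum w ≡ 0 → tailChain w ≡ 1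
  tailChain-sum≡0 (x Vec.∷ Vec.[])      _  = refl
  tailChain-sum≡0 (x Vec.∷ w@(_ Vec.∷ _)) sum≡0 =
    trans (tailChain-∷ x w)
      (trans (cong₂ (λ a b → stirling1 (a + b) b * tailChain w) (m+n≡0⇒m≡0 x sum≡0) (m+n≡0⇒n≡0 x sum≡0))
             (cong (stirling1 0 0 *_) (tailChain-sum≡0 w (m+n≡0⇒n≡0 x sum≡0))))

  -- The weight of j − eᵢ in the recurrence for the coefficient of j: αᵢ(j) − 1 for i < N and 1 for i = N.
  recurrenceFactor : ∀ {n} → ℕ → Vec ℕ (suc n) → ℕ
  recurrenceFactor i       (x Vec.∷ Vec.[])      = 1
  recurrenceFactor zero    (x Vec.∷ y Vec.∷ v) = (x + Vec.sum (y Vec.∷ v)) ∸ 1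
  recurrenceFactor (suc i) (x Vec.∷ y Vec.∷ v) = recurrenceFactor i (y Vec.∷ v)

  recurrenceFactor-last : ∀ {n} (k : Vec ℕ (suc n)) → recurrenceFactor n k ≡ 1
  recurrenceFactor-last {zero}  (x Vec.∷ Vec.[])      = refl
  recurrenceFactor-last {suc n} (x Vec.∷ y Vec.∷ v) = recurrenceFactor-last (y Vec.∷ v)

  entry-tailSums-decrementAt-< : ∀ {n} i (k : Vec ℕ (suc n)) → i < n → isPositive (entry i k) ≡ true →
    entry i (tailSums (decrementAt i k)) ≡ recurrenceFactor i k
  entry-tailSums-decrementAt-< zero    (suc x Vec.∷ y Vec.∷ v) _       _   = refl
  entry-tailSums-decrementAt-< (suc i) (x Vec.∷ y Vec.∷ v)     (s≤s p) pos = entry-tailSums-decrementAt-< i (y Vec.∷ v) p pos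

  recurrenceTerm : ∀ {N} (k : Vec ℕ (suc N)) → ℕ → ℕ
  recurrenceTerm k i = if isPositive (entry i k) then recurrenceFactor i k * tailChain (decrementAt i k) else 0

  recurrenceTerm-zero : ∀ {n} x (k : Vec ℕ (suc n)) → recurrenceTerm (x Vec.∷ k) 0 ≡
    (if isPositive x then (x + Vec.sum k ∸ 1) * (stirling1 ((x ∸ 1) + Vec.sum k) (Vec.sum k) * tailChain k) else 0)
  recurrenceTerm-zero zero    k = refl
  recurrenceTerm-zero (suc u) k@(_ Vec.∷ _) = cong ((u + Vec.sum k) *_) (tailChain-∷ u k)

  -- The Stirling recurrence for [x + s, s], multiplied by the chain P after it; Q plays the
  -- part of P for the chain that continues from [x + s − 1, s − 1].
  stirling1-recurrence-chained : ∀ x s P Q → (s ≡ 0 → P ≡ 1) → (s ≡ 0 → Q ≡ 0) → (1 ≤ s → P ≡ Q) → 1 ≤ x + s →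
    stirling1 (x + s) s * P ≡
      (if isPositive x then (x + s ∸ 1) * (stirling1 ((x ∸ 1) + s) s * P) else 0) + stirling1 (x + (s ∸ 1)) (s ∸ 1) * Q
  stirling1-recurrence-chained zero    zero    P Q _   _   _   ()
  stirling1-recurrence-chained (suc u) zero    P Q P≡1 Q≡0 _   _ rewrite P≡1 refl | Q≡0 refl | +-identityʳ u = edge u
    where
    edge : ∀ u → stirling1 (suc u) 0 * 1 ≡ u * (stirling1 u 0 * 1) + stirling1 (suc u) 0 * 0
    edge zero    = refl
    edge (suc w) rewrite stirling1-suc-zero w | stirling1-suc-zero (suc w) | *-zeroʳ w = refl
  stirling1-recurrence-chained zero    (suc t) P Q _   _   P≡Q _ rewrite P≡Q (s≤s z≤n) | stirling1-diag (suc t) | stirling1-diag t = refl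
  stirling1-recurrence-chained (suc u) (suc t) P Q _   _   P≡Q _
    rewrite P≡Q (s≤s z≤n) | stirling1-suc-suc (u + suc t) t | +-suc u t =
    solve 4 (λ a b c q → (a :* b :+ c) :* q := a :* (b :* q) :+ c :* q) refl
      (suc (u + t)) (stirling1 (suc (u + t)) (suc t)) (stirling1 (suc (u + t)) t) Q

  tailChain-recurrence : ∀ N (k : Vec ℕ (suc N)) → 1 ≤ Vec.sum k → tailChain k ≡ ∑ℕ (upTo (suc N)) (recurrenceTerm k)
  tailChain-recurrence zero    (suc x Vec.∷ Vec.[]) _ = refl
  tailChain-recurrence (suc N) (x Vec.∷ k'@(y Vec.∷ v)) 1≤sum = begin
    tailChain (x Vec.∷ k')
      ≡⟨ tailChain-∷ x k' ⟩
    stirling1 (x + s) s * tailChain k'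
      ≡⟨ stirling1-recurrence-chained x s (tailChain k') Q (tailChain-sum≡0 k') Q≡0 (tailChain-recurrence N k') 1≤sum ⟩
    (if isPositive x then (x + s ∸ 1) * (stirling1 ((x ∸ 1) + s) s * tailChain k') else 0) + S′ * Q
      ≡⟨ cong₂ _+_ (sym (recurrenceTerm-zero x k')) (sym (trans (∑ℕ-cong (upTo (suc N)) later) (∑ℕ-*ˡ S′ (upTo (suc N)) (recurrenceTerm k')))) ⟩
    recurrenceTerm k 0 + ∑ℕ (upTo (suc N)) (recurrenceTerm k ∘′ suc)
      ≡⟨ cong (_+_ (recurrenceTerm k 0)) (sym (∑ℕ-applyUpTo (recurrenceTerm k) suc (suc N))) ⟩
    ∑ℕ (upTo (suc (suc N))) (recurrenceTerm k) ∎
    where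
    open ≡-Reasoning
    k = x Vec.∷ k'
    s = Vec.sum k'
    Q = ∑ℕ (upTo (suc N)) (recurrenceTerm k')
    S′ = stirling1 (x + (s ∸ 1)) (s ∸ 1)
    Q≡0 : s ≡ 0 → Q ≡ 0
    Q≡0 s≡0 = ∑ℕ-zero (upTo (suc N)) λ i →
      cong (λ b → if isPositive b then recurrenceFactor i k' * tailChain (decrementAt i k') else 0) (entry-sum≡0 i k' s≡0)
    later : ∀ i → recurrenceTerm k (suc i) ≡ S′ * recurrenceTerm k' i
    later i with isPositive (entry i k') in pos
    ... | false = sym (*-zeroʳ S′)
    ... | true  rewrite tailChain-∷ x (decrementAt i k') | sym (cong (_∸ 1) (sum-decrementAt i k' pos)) =
      solve 3 (λ a b c → a :* (b :* c) := b :* (a :* c)) refl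
        (recurrenceFactor i k') (stirling1 (x + Vec.sum (decrementAt i k')) (Vec.sum (decrementAt i k'))) (tailChain (decrementAt i k'))

module Expansion {c ℓ} (R : CommutativeRing c ℓ) (inv! : ℕ → CommutativeRing.Carrier R) where
  open CommutativeRing R renaming (Carrier to A; refl to ≈-refl; sym to ≈-sym; trans to ≈-trans; reflexive to ≈-reflexive)
  open Setup R inv!
  open Compositions
  open StirlingChains
  open import Algebra.Definitions.RawSemiring (Semiring.rawSemiring semiring) using () renaming (_^_ to _^ℕ_)
  open RingProperties ring using (-1*x≈-x; -‿distribʳ-*; -‿distribˡ-*; -0#≈0#)
  open import Algebra.Properties.Semiring.Mult semiring using (×-homo-+; ×-homo-1; ×1-homo-*)
  module *-Solver = CommutativeMonoidSolver *-commutativeMonoid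
  open *-Solver using () renaming (_⊕_ to _∙_)
  open import Tactic.RingSolver.NonReflective (fromCommutativeRing R (λ _ → nothing)) using (solve; _⊜_; _⊕_; _⊗_; ⊝_)

  ≡⇒∼ : ∀ {s t} → s ≡ t → s ∼ t
  ≡⇒∼ refl = ∼-refl

  ∼-++ˡ : ∀ {s s'} t → s ∼ s' → s ++ t ∼ s' ++ t
  ∼-++ˡ t ∼-refl            = ∼-refl
  ∼-++ˡ t (∼-sym p)         = ∼-sym (∼-++ˡ t p)
  ∼-++ˡ t (∼-trans p q)     = ∼-trans (∼-++ˡ t p) (∼-++ˡ t q)
  ∼-++ˡ t (∼-cons x p)      = ∼-cons x (∼-++ˡ t p)
  ∼-++ˡ t (∼-swap x y u)    = ∼-swap x y (u ++ t)
  ∼-++ˡ t (∼-merge u e)     = ∼-merge (u ++ t) e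
  ∼-++ˡ t (∼-zero m u e)    = ∼-zero m (u ++ t) e
  ∼-++ˡ t (∼-coeff m u e)   = ∼-coeff m (u ++ t) e
  ∼-++ˡ t (∼-mono a u e)    = ∼-mono a (u ++ t) e

  ∼-++ʳ : ∀ s {t t'} → t ∼ t' → s ++ t ∼ s ++ t'
  ∼-++ʳ []      p = p
  ∼-++ʳ (x ∷ s) p = ∼-cons x (∼-++ʳ s p)

  ∼-++ : ∀ {s s' t t'} → s ∼ s' → t ∼ t' → s ++ t ∼ s' ++ t'
  ∼-++ {s' = s'} {t = t} p q = ∼-trans (∼-++ˡ t p) (∼-++ʳ s' q)

  ↭⇒∼ : ∀ {s t} → s ↭ t → s ∼ t
  ↭⇒∼ ↭.refl         = ∼-refl
  ↭⇒∼ (↭.prep x p)   = ∼-cons x (↭⇒∼ p)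
  ↭⇒∼ (↭.swap x y p) = ∼-trans (∼-swap x y _) (∼-cons y (∼-cons x (↭⇒∼ p)))
  ↭⇒∼ (↭.trans p q)  = ∼-trans (↭⇒∼ p) (↭⇒∼ q)

  •-congʳ : ∀ a {s t} → s ∼ t → a • s ∼ a • t
  •-congʳ a ∼-refl                       = ∼-refl
  •-congʳ a (∼-sym p)                    = ∼-sym (•-congʳ a p)
  •-congʳ a (∼-trans p q)                = ∼-trans (•-congʳ a p) (•-congʳ a q)
  •-congʳ a (∼-cons x p)                 = ∼-cons _ (•-congʳ a p)
  •-congʳ a (∼-swap x y t)               = ∼-swap _ _ _
  •-congʳ a (∼-merge {b} {b'} t e)       = ∼-trans (∼-merge _ e) (∼-coeff _ _ (≈-sym (distribˡ a b b')))
  •-congʳ a (∼-zero m t e)               = ∼-zero m _ (≈-trans (*-congˡ e) (zeroʳ a))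
  •-congʳ a (∼-coeff m t e)              = ∼-coeff m _ (*-congˡ e)
  •-congʳ a (∼-mono b t e)               = ∼-mono _ _ e

  •-congˡ : ∀ {a b} → a ≈ b → ∀ s → a • s ∼ b • s
  •-congˡ a≈b []             = ∼-refl
  •-congˡ a≈b ((x , m) ∷ s) = ∼-trans (∼-coeff m _ (*-congʳ a≈b)) (∼-cons _ (•-congˡ a≈b s))

  •-zeroˡ : ∀ {a} → a ≈ 0# → ∀ s → a • s ∼ []
  •-zeroˡ a≈0 []             = ∼-refl
  •-zeroˡ a≈0 ((x , m) ∷ s) = ∼-trans (∼-zero m _ (≈-trans (*-congʳ a≈0) (zeroˡ x))) (•-zeroˡ a≈0 s)

  •-distribʳ : ∀ a b s → (a + b) • s ∼ a • s ++ b • s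
  •-distribʳ a b []             = ∼-refl
  •-distribʳ a b ((x , m) ∷ s) = ∼-sym
    (∼-trans (∼-cons _ (↭⇒∼ (↭ₚ.shift (b * x , m) (a • s) (b • s))))
    (∼-trans (∼-merge _ (λ _ → ≈-refl))
    (∼-trans (∼-coeff m _ (≈-sym (distribʳ x a b)))
             (∼-cons _ (∼-sym (•-distribʳ a b s))))))

  •-map : ∀ {a} {X : Set a} b (f : X → A × Mono) xs → b • map f xs ≡ map (λ x → (b * proj₁ (f x) , proj₂ (f x))) xs
  •-map b f []       = refl
  •-map b f (x ∷ xs) = ≡.cong (_ ∷_) (•-map b f xs)

  ∑ : ∀ {a} {X : Set a} → List X → (X → A) → A
  ∑ []       f = 0#
  ∑ (x ∷ xs) f = f x + ∑ xs f

  ∑-cong : ∀ {a} {X : Set a} (xs : List X) {f g : X → A} → (∀ x → f x ≈ g x) → ∑ xs f ≈ ∑ xs g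
  ∑-cong []       f≈g = ≈-refl
  ∑-cong (x ∷ xs) f≈g = +-cong (f≈g x) (∑-cong xs f≈g)

  ∑-upTo-cong : ∀ n {f g : ℕ → A} → (∀ t → t ℕ.< n → f t ≈ g t) → ∑ (upTo n) f ≈ ∑ (upTo n) g
  ∑-upTo-cong n = shifted n (λ t → t)
    where
    shifted : ∀ n h {f g : ℕ → A} → (∀ t → t ℕ.< n → f (h t) ≈ g (h t)) → ∑ (applyUpTo h n) f ≈ ∑ (applyUpTo h n) g
    shifted zero    h f≈g = ≈-refl
    shifted (suc n) h f≈g = +-cong (f≈g 0 ℕ.z<s) (shifted n (h ∘′ suc) (λ t t<n → f≈g (suc t) (ℕ.s≤s t<n)))

  ∑-zero : ∀ {a} {X : Set a} (xs : List X) {f : X → A} → (∀ x → f x ≈ 0#) → ∑ xs f ≈ 0#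
  ∑-zero []       f≈0 = ≈-refl
  ∑-zero (x ∷ xs) f≈0 = ≈-trans (+-cong (f≈0 x) (∑-zero xs f≈0)) (+-identityˡ 0#)

  ∑-++ : ∀ {a} {X : Set a} (xs ys : List X) (f : X → A) → ∑ (xs ++ ys) f ≈ ∑ xs f + ∑ ys f
  ∑-++ []       ys f = ≈-sym (+-identityˡ _)
  ∑-++ (x ∷ xs) ys f = ≈-trans (+-congˡ (∑-++ xs ys f)) (≈-sym (+-assoc _ _ _))

  ∑-concatMap : ∀ {a b} {X : Set a} {Y : Set b} (G : X → List Y) xs (f : Y → A) → ∑ (concatMap G xs) f ≈ ∑ xs (λ x → ∑ (G x) f)
  ∑-concatMap G []       f = ≈-refl
  ∑-concatMap G (x ∷ xs) f = ≈-trans (∑-++ (G x) (concatMap G xs) f) (+-congˡ (∑-concatMap G xs f))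

  ∑-map : ∀ {a b} {X : Set a} {Y : Set b} (h : X → Y) xs (f : Y → A) → ∑ (map h xs) f ≡ ∑ xs (f ∘′ h)
  ∑-map h []       f = refl
  ∑-map h (x ∷ xs) f = ≡.cong (_+_ (f (h x))) (∑-map h xs f)

  ∑-+ : ∀ {a} {X : Set a} (xs : List X) (f g : X → A) → ∑ xs (λ x → f x + g x) ≈ ∑ xs f + ∑ xs g
  ∑-+ []       f g = ≈-sym (+-identityˡ 0#)
  ∑-+ (x ∷ xs) f g = ≈-trans (+-congˡ (∑-+ xs f g))
    (solve 4 (λ a b c d → ((a ⊕ b) ⊕ (c ⊕ d)) ⊜ ((a ⊕ c) ⊕ (b ⊕ d))) ≈-refl (f x) (g x) (∑ xs f) (∑ xs g))

  ∑-comm : ∀ {a b} {X : Set a} {Y : Set b} (xs : List X) (ys : List Y) (f : X → Y → A) →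
    ∑ xs (λ x → ∑ ys (f x)) ≈ ∑ ys (λ y → ∑ xs (λ x → f x y))
  ∑-comm []       ys f = ≈-sym (∑-zero ys (λ _ → ≈-refl))
  ∑-comm (x ∷ xs) ys f = ≈-trans (+-congˡ (∑-comm xs ys f)) (≈-sym (∑-+ ys (f x) _))

  ∑-*ˡ : ∀ {a} {X : Set a} b (xs : List X) (f : X → A) → ∑ xs (λ x → b * f x) ≈ b * ∑ xs f
  ∑-*ˡ b []       f = ≈-sym (zeroʳ b)
  ∑-*ˡ b (x ∷ xs) f = ≈-trans (+-congˡ (∑-*ˡ b xs f)) (≈-sym (distribˡ b _ _))

  ∑-δ : ∀ n x (h : ℕ → A) → ∑ (upTo n) (λ j → if j ℕ.≡ᵇ x then h j else 0#) ≈ (if x ℕ.<ᵇ n then h x else 0#)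
  ∑-δ zero    x h = ≈-refl
  ∑-δ (suc n) x h =
    ≈-trans (≈-reflexive (≡.cong (λ l → ∑ l δₓ) (≡.sym (List.upTo-∷ʳ n))))
      (≈-trans (∑-++ (upTo n) (n ∷ []) δₓ) (≈-trans (+-cong (∑-δ n x h) (+-identityʳ _)) (last (ℕₚ.<-cmp x n))))
    where
    δₓ = λ j → if j ℕ.≡ᵇ x then h j else 0#
    last : Tri (x ℕ.< n) (x ≡ n) (n ℕ.< x) → (if x ℕ.<ᵇ n then h x else 0#) + δₓ n ≈ (if x ℕ.<ᵇ suc n then h x else 0#)
    last (tri< x<n x≢n _)
      rewrite <⇒<ᵇ≡true x<n | <⇒<ᵇ≡true (ℕₚ.m<n⇒m<1+n x<n) | ≢⇒≡ᵇ≡false (≡.≢-sym x≢n) = +-identityʳ _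
    last (tri≈ _ refl _)
      rewrite ≥⇒<ᵇ≡false (ℕₚ.≤-refl {x}) | <⇒<ᵇ≡true (ℕₚ.n<1+n x) | ≡ᵇ-refl x = +-identityˡ _
    last (tri> _ x≢n n<x)
      rewrite ≥⇒<ᵇ≡false (ℕₚ.<⇒≤ n<x) | ≥⇒<ᵇ≡false n<x | ≢⇒≡ᵇ≡false (≡.≢-sym x≢n) = +-identityˡ _

  fromℕ-+ : ∀ a b → fromℕ (a ℕ.+ b) ≈ fromℕ a + fromℕ b
  fromℕ-+ = ×-homo-+ 1#

  fromℕ-* : ∀ a b → fromℕ (a ℕ.* b) ≈ fromℕ a * fromℕ b
  fromℕ-* = ×1-homo-*

  fromℕ-1 : fromℕ 1 ≈ 1#
  fromℕ-1 = ×-homo-1 1#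

  fromℕ-cong : ∀ {a b} → a ≡ b → fromℕ a ≈ fromℕ b
  fromℕ-cong = ≈-reflexive ∘′ ≡.cong fromℕ

  fromℕ-∑ℕ : ∀ xs (f : ℕ → ℕ) → fromℕ (∑ℕ xs f) ≈ ∑ xs (fromℕ ∘′ f)
  fromℕ-∑ℕ []       f = ≈-refl
  fromℕ-∑ℕ (x ∷ xs) f = ≈-trans (fromℕ-+ (f x) _) (+-congˡ (fromℕ-∑ℕ xs f))

  module Collect {K : Set} (_≟_ : DecidableEquality K) where

    coefficientOf : List (A × K) → K → A
    coefficientOf []             k = 0#
    coefficientOf ((a , k') ∷ E) k = if does (k' ≟ k) then a + coefficientOf E k else coefficientOf E k

    embed : (K → Mono) → List (A × K) → Elem
    embed F = map (map₂ F)

    collect : (K → Mono) → List K → List (A × K) → Elem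
    collect F ks E = map (λ k → (coefficientOf E k , F k)) ks

    coefficientOf-≢ : ∀ {a k k'} E → k ≢ k' → coefficientOf ((a , k) ∷ E) k' ≈ coefficientOf E k'
    coefficientOf-≢ {k = k} {k'} E k≢k' rewrite dec-false (k ≟ k') k≢k' = ≈-refl

    coefficientOf-≡ : ∀ {a} k E → coefficientOf ((a , k) ∷ E) k ≈ a + coefficientOf E k
    coefficientOf-≡ k E rewrite dec-true (k ≟ k) refl = ≈-refl

    coefficientOf≈∑ : ∀ E k → coefficientOf E k ≈ ∑ E (λ p → if does (proj₂ p ≟ k) then proj₁ p else 0#)
    coefficientOf≈∑ []             k = ≈-refl
    coefficientOf≈∑ ((a , k') ∷ E) k with k' ≟ k
    ... | yes _ = +-congˡ (coefficientOf≈∑ E k)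
    ... | no  _ = ≈-trans (coefficientOf≈∑ E k) (≈-sym (+-identityˡ _))

    collect-cong : ∀ F ks E E' → All (λ k → coefficientOf E k ≈ coefficientOf E' k) ks → collect F ks E ∼ collect F ks E'
    collect-cong F []       E E' []       = ∼-refl
    collect-cong F (k ∷ ks) E E' (e ∷ es) = ∼-trans (∼-coeff _ _ e) (∼-cons _ (collect-cong F ks E E' es))

    collect-[] : ∀ F ks → collect F ks [] ∼ []
    collect-[] F []       = ∼-refl
    collect-[] F (k ∷ ks) = ∼-trans (∼-zero _ _ ≈-refl) (collect-[] F ks)

    collect-∷ : ∀ F a k ks E → k ∈ ks → Unique ks → (a , F k) ∷ collect F ks E ∼ collect F ks ((a , k) ∷ E)
    collect-∷ F a k (.k ∷ ks) E (here refl) (k∉ks ∷ _) =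
      ∼-trans (∼-merge _ (λ _ → ≈-refl))
        (∼-trans (∼-coeff _ _ (≈-sym (coefficientOf-≡ k E)))
          (∼-cons _ (collect-cong F ks E ((a , k) ∷ E) (All.map (λ k≢k' → ≈-sym (coefficientOf-≢ E k≢k')) k∉ks))))
    collect-∷ F a k (k' ∷ ks) E (there k∈ks) (k'∉ks ∷ ks!) =
      ∼-trans (∼-swap _ _ _)
        (∼-trans (∼-coeff _ _ (≈-sym (coefficientOf-≢ E (≡.≢-sym (All.lookup k'∉ks k∈ks)))))
          (∼-cons _ (collect-∷ F a k ks E k∈ks ks!)))

    embed∼collect : ∀ F ks E → All (λ p → proj₂ p ∈ ks) E → Unique ks → embed F E ∼ collect F ks E
    embed∼collect F ks []             []            _   = ∼-sym (collect-[] F ks)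
    embed∼collect F ks ((a , k) ∷ E) (k∈ks ∷ E⊆ks) ks! =
      ∼-trans (∼-cons _ (embed∼collect F ks E E⊆ks ks!)) (collect-∷ F a k ks E k∈ks ks!)

    -- The common normal form lists each key occurring in E or E' once, with its total coefficient.
    embed-cong : ∀ F E E' → (∀ k → coefficientOf E k ≈ coefficientOf E' k) → embed F E ∼ embed F E'
    embed-cong F E E' same =
      ∼-trans (embed∼collect F ks E (covers E ∈-++⁺ˡ) ks!)
        (∼-trans (collect-cong F ks E E' (All.tabulate λ {k} _ → same k))
          (∼-sym (embed∼collect F ks E' (covers E' (∈-++⁺ʳ (keys E))) ks!)))
      where
      keys : List (A × K) → List K
      keys = map proj₂
      ks = deduplicate _≟_ (keys E ++ keys E')
      ks! = Unique.deduplicate-! _≟_ (keys E ++ keys E')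
      covers : ∀ E″ → (∀ {k} → k ∈ keys E″ → k ∈ keys E ++ keys E') → All (λ p → proj₂ p ∈ ks) E″
      covers E″ into = All.tabulate λ p∈E″ → ∈-deduplicate⁺ _≟_ (into (∈-map⁺ proj₂ p∈E″))

  expo-++ : ∀ a b n → expo (a ++ b) n ≈ expo a n + expo b n
  expo-++ []            b n = ≈-sym (+-identityˡ _)
  expo-++ ((i , x) ∷ a) b n with i ℤ.≟ n
  ... | yes _ = ≈-trans (+-congˡ (expo-++ a b n)) (≈-sym (+-assoc _ _ _))
  ... | no  _ = expo-++ a b n

  ≈ₘ-∷ : ∀ x m m' → m ≈ₘ m' → (x ∷ m) ≈ₘ (x ∷ m')
  ≈ₘ-∷ (i , x) m m' m≈m' n with i ℤ.≟ n
  ... | yes _ = +-congˡ (m≈m' n)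
  ... | no  _ = m≈m' n

  ≈ₘ-++ : ∀ p m m' → m ≈ₘ m' → (p ++ m) ≈ₘ (p ++ m')
  ≈ₘ-++ []      m m' m≈m' = m≈m'
  ≈ₘ-++ (x ∷ p) m m' m≈m' = ≈ₘ-∷ x (p ++ m) (p ++ m') (≈ₘ-++ p m m' m≈m')

  module ℤCollect = Collect ℤ._≟_
  open ℤCollect using () renaming (coefficientOf to coefficientOfℤ)

  asTerms : Mono → List (A × ℤ)
  asTerms = map swap

  coefficientOf-asTerms : ∀ m n → coefficientOfℤ (asTerms m) n ≈ expo m n
  coefficientOf-asTerms []            n = ≈-refl
  coefficientOf-asTerms ((i , a) ∷ m) n with i ℤ.≟ n
  ... | yes _ = +-congˡ (coefficientOf-asTerms m n)
  ... | no  _ = coefficientOf-asTerms m n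

  loweredAt : Mono → ℤ → Mono
  loweredAt m i = (i , - 1#) ∷ cfactor i ++ m

  dMono≡embed : ∀ m → dMono m ≡ ℤCollect.embed (loweredAt m) (asTerms m)
  dMono≡embed m = go m
    where
    go : ∀ m' → map (λ { (i , a) → (a , loweredAt m i) }) m' ≡ ℤCollect.embed (loweredAt m) (asTerms m')
    go []       = refl
    go (x ∷ m') = ≡.cong (_ ∷_) (go m')

  embed-≈ₘ : ∀ {K : Set} (_≟_ : DecidableEquality K) {F G : K → Mono} E → (∀ k → F k ≈ₘ G k) →
    Collect.embed _≟_ F E ∼ Collect.embed _≟_ G E
  embed-≈ₘ _≟_ []             F≈G = ∼-refl
  embed-≈ₘ _≟_ ((a , k) ∷ E) F≈G = ∼-trans (∼-mono a _ (F≈G k)) (∼-cons _ (embed-≈ₘ _≟_ E F≈G))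

  map-upTo-≈ₘ : ∀ n (a : ℕ → A) {F G : ℕ → Mono} → (∀ t → t ℕ.< n → F t ≈ₘ G t) →
    map (λ t → (a t , F t)) (upTo n) ∼ map (λ t → (a t , G t)) (upTo n)
  map-upTo-≈ₘ n a = shifted n (λ t → t)
    where
    shifted : ∀ n h {F G : ℕ → Mono} → (∀ t → t ℕ.< n → F (h t) ≈ₘ G (h t)) →
      map (λ t → (a t , F t)) (applyUpTo h n) ∼ map (λ t → (a t , G t)) (applyUpTo h n)
    shifted zero    h F≈G = ∼-refl
    shifted (suc n) h F≈G =
      ∼-trans (∼-mono _ _ (F≈G 0 ℕ.z<s)) (∼-cons _ (shifted n (h ∘′ suc) (λ t t<n → F≈G (suc t) (ℕ.s≤s t<n))))

  dMono-cong : ∀ {m m'} → m ≈ₘ m' → dMono m ∼ dMono m'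
  dMono-cong {m} {m'} m≈m' =
    ∼-trans (≡⇒∼ (dMono≡embed m))
      (∼-trans (ℤCollect.embed-cong (loweredAt m) (asTerms m) (asTerms m')
                 (λ n → ≈-trans (coefficientOf-asTerms m n) (≈-trans (m≈m' n) (≈-sym (coefficientOf-asTerms m' n)))))
        (∼-trans (embed-≈ₘ ℤ._≟_ (asTerms m')
                   (λ i → ≈ₘ-∷ (i , - 1#) (cfactor i ++ m) (cfactor i ++ m') (≈ₘ-++ (cfactor i) m m' m≈m')))
          (≡⇒∼ (≡.sym (dMono≡embed m')))))

  d-++ : ∀ s t → d (s ++ t) ≡ d s ++ d t
  d-++ []            t = refl
  d-++ ((a , m) ∷ s) t = ≡.trans (≡.cong (a • dMono m ++_) (d-++ s t)) (≡.sym (List.++-assoc (a • dMono m) (d s) (d t)))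

  d-cong : ∀ {s t} → s ∼ t → d s ∼ d t
  d-cong ∼-refl                        = ∼-refl
  d-cong (∼-sym p)                     = ∼-sym (d-cong p)
  d-cong (∼-trans p q)                 = ∼-trans (d-cong p) (d-cong q)
  d-cong (∼-cons (a , m) p)            = ∼-++ʳ (a • dMono m) (d-cong p)
  d-cong (∼-swap (a , m) (b , m') t)   = ↭⇒∼ (↭ₚ.shifts (a • dMono m) (b • dMono m'))
  d-cong (∼-merge {a} {b} {m} t m≈m')  =
    ∼-trans (∼-++ʳ (a • dMono m) (∼-++ˡ (d t) (•-congʳ b (dMono-cong (λ n → ≈-sym (m≈m' n))))))
      (∼-trans (≡⇒∼ (≡.sym (List.++-assoc (a • dMono m) (b • dMono m) (d t))))
        (∼-++ˡ (d t) (∼-sym (•-distribʳ a b (dMono m)))))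
  d-cong (∼-zero m t a≈0)              = ∼-++ˡ (d t) (•-zeroˡ a≈0 (dMono m))
  d-cong (∼-coeff m t a≈b)             = ∼-++ˡ (d t) (•-congˡ a≈b (dMono m))
  d-cong (∼-mono a t m≈m')             = ∼-++ˡ (d t) (•-congʳ a (dMono-cong m≈m'))

  run : ℕ → List A → Mono
  run o []       = []
  run o (a ∷ as) = (+ o , a) ∷ run (suc o) as

  at : List A → ℕ → A
  at []       _       = 0#
  at (a ∷ as) zero    = a
  at (a ∷ as) (suc t) = at as t

  zipWith-applyUpTo≡run : ∀ {n} (f : ℕ → A) (g : ℕ → ℕ) o (v : Vec ℕ n) → (∀ t → g t ≡ o ℕ.+ t) →
    zipWith (λ i α → (+ i , f α)) (applyUpTo g n) (Vec.toList v) ≡ run o (map f (Vec.toList v))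
  zipWith-applyUpTo≡run f g o Vec.[]       _     = refl
  zipWith-applyUpTo≡run f g o (x Vec.∷ v) g≗o+ =
    ≡.cong₂ (λ i rest → (+ i , f x) ∷ rest) (≡.trans (g≗o+ 0) (ℕₚ.+-identityʳ o))
      (zipWith-applyUpTo≡run f (g ∘′ suc) (suc o) v (λ t → ≡.trans (g≗o+ (suc t)) (ℕₚ.+-suc o t)))

  map-applyUpTo≡run : ∀ (g : ℕ → ℕ) o n → (∀ t → g t ≡ o ℕ.+ t) →
    map (λ k → (+ k , - 1#)) (applyUpTo g n) ≡ run o (replicate n (- 1#))
  map-applyUpTo≡run g o zero    _     = refl
  map-applyUpTo≡run g o (suc n) g≗o+ =
    ≡.cong₂ (λ i rest → (+ i , - 1#) ∷ rest) (≡.trans (g≗o+ 0) (ℕₚ.+-identityʳ o))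
      (map-applyUpTo≡run (g ∘′ suc) (suc o) n (λ t → ≡.trans (g≗o+ (suc t)) (ℕₚ.+-suc o t)))

  expo-run-< : ∀ o as t → t ℕ.< o → expo (run o as) (+ t) ≈ 0#
  expo-run-< o []       t _   = ≈-refl
  expo-run-< o (a ∷ as) t t<o with + o ℤ.≟ + t
  ... | yes refl = ⊥-elim (ℕₚ.n≮n o t<o)
  ... | no  _    = expo-run-< (suc o) as t (ℕₚ.m<n⇒m<1+n t<o)

  expo-run-+ : ∀ o as t → expo (run o as) (+ (o ℕ.+ t)) ≈ at as t
  expo-run-+ o []       t       = ≈-refl
  expo-run-+ o (a ∷ as) zero    rewrite ℕₚ.+-identityʳ o with + o ℤ.≟ + o
  ... | yes _  = ≈-trans (+-congˡ (expo-run-< (suc o) as o (ℕₚ.n<1+n o))) (+-identityʳ a)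
  ... | no o≢o = ⊥-elim (o≢o refl)
  expo-run-+ o (a ∷ as) (suc t) rewrite ℕₚ.+-suc o t with + o ℤ.≟ + suc (o ℕ.+ t)
  ... | yes o≡ = ⊥-elim (ℕₚ.m≢1+m+n o (ℤₚ.+-injective o≡))
  ... | no  _  = expo-run-+ (suc o) as t

  expo-run-neg : ∀ o as m → expo (run o as) -[1+ m ] ≈ 0#
  expo-run-neg o []       m = ≈-refl
  expo-run-neg o (a ∷ as) m = expo-run-neg (suc o) as m

  at-replicate : ∀ n (x : A) t → at (replicate n x) t ≡ (if t ℕ.<ᵇ n then x else 0#)
  at-replicate zero    x t       = refl
  at-replicate (suc n) x zero    = refl
  at-replicate (suc n) x (suc t) = at-replicate n x t

  at-negated : ∀ {n} (v : Vec ℕ n) t → at (map (λ α → - fromℕ α) (Vec.toList v)) t ≈ - fromℕ (entry t v)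
  at-negated Vec.[]       t       = ≈-sym -0#≈0#
  at-negated (x Vec.∷ v) zero    = ≈-refl
  at-negated (x Vec.∷ v) (suc t) = at-negated v t

  cfactor-run : ∀ i → cfactor (+ i) ≡ run 0 (replicate i (- 1#))
  cfactor-run zero    = refl
  cfactor-run (suc i) = map-applyUpTo≡run (λ t → t) 0 (suc i) (λ t → refl)

  expo-cfactor-+ : ∀ i t → expo (cfactor (+ i)) (+ t) ≈ (if t ℕ.<ᵇ i then - 1# else 0#)
  expo-cfactor-+ i t rewrite cfactor-run i = ≈-trans (expo-run-+ 0 (replicate i (- 1#)) t) (≈-reflexive (at-replicate i (- 1#) t))

  expo-cfactor-neg : ∀ i m → expo (cfactor (+ i)) -[1+ m ] ≈ 0#
  expo-cfactor-neg i m rewrite cfactor-run i = expo-run-neg 0 (replicate i (- 1#)) m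

  if-+ : ∀ b x y → (if b then x + y else y) ≈ (if b then x else 0#) + y
  if-+ true  x y = ≈-refl
  if-+ false x y = ≈-sym (+-identityˡ y)

  ∑-compositions-δ : ∀ n m (k : Vec ℕ (suc n)) (g : Vec ℕ (suc n) → A) →
    ∑ (compositions m n) (λ j → if does (j ≟ᵛ k) then g j else 0#) ≈ (if Vec.sum k ℕ.≡ᵇ m then g k else 0#)
  ∑-compositions-δ zero m (x Vec.∷ Vec.[]) g rewrite ℕₚ.+-identityʳ x with m ℕ.≟ x
  ... | yes refl rewrite ≡ᵇ-refl m = +-identityʳ _
  ... | no  m≢x  rewrite ≢⇒≡ᵇ≡false m≢x | ≢⇒≡ᵇ≡false (≡.≢-sym m≢x) = +-identityʳ _
  ∑-compositions-δ (suc n) m (x Vec.∷ k') g =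
    ≈-trans (∑-concatMap prepend (upTo (suc m)) δₖ)
      (≈-trans (∑-cong (upTo (suc m))
                 (λ j₀ → ≈-trans (≈-reflexive (∑-map (j₀ Vec.∷_) (compositions (m ℕ.∸ j₀) n) δₖ)) (first j₀)))
        (≈-trans (∑-δ (suc m) x restδ) final))
    where
    δₖ = λ j → if does (j ≟ᵛ x Vec.∷ k') then g j else 0#
    prepend = λ j₀ → map (j₀ Vec.∷_) (compositions (m ℕ.∸ j₀) n)
    restδ = λ j₀ → if Vec.sum k' ℕ.≡ᵇ (m ℕ.∸ j₀) then g (j₀ Vec.∷ k') else 0#
    first : ∀ j₀ → ∑ (compositions (m ℕ.∸ j₀) n) (δₖ ∘′ (j₀ Vec.∷_)) ≈ (if j₀ ℕ.≡ᵇ x then restδ j₀ else 0#)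
    first j₀ with j₀ ℕ.≡ᵇ x
    ... | true  = ∑-compositions-δ n (m ℕ.∸ j₀) k' (g ∘′ (j₀ Vec.∷_))
    ... | false = ∑-zero (compositions (m ℕ.∸ j₀) n) (λ _ → ≈-refl)
    final : (if x ℕ.<ᵇ suc m then restδ x else 0#) ≈ (if Vec.sum (x Vec.∷ k') ℕ.≡ᵇ m then g (x Vec.∷ k') else 0#)
    final with ℕₚ.≤-<-connex x m
    ... | inj₁ x≤m rewrite <⇒<ᵇ≡true (ℕ.s≤s x≤m) | ≡ᵇ-∸ x m (Vec.sum k') x≤m = ≈-refl
    ... | inj₂ m<x rewrite ≥⇒<ᵇ≡false m<x
                         | ≢⇒≡ᵇ≡false {x ℕ.+ Vec.sum k'} {m}
                             (λ e → ℕₚ.<⇒≢ (ℕₚ.≤-trans m<x (ℕₚ.m≤m+n x (Vec.sum k'))) (≡.sym e)) = ≈-refl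

  sign : ℕ → A
  sign e = (- 1#) ^ℕ e

  stirProd≈stirlingChain : ∀ αs → stirProd αs ≈ fromℕ (stirlingChain αs)
  stirProd≈stirlingChain []              = ≈-sym fromℕ-1
  stirProd≈stirlingChain (a ∷ [])        = ≈-sym fromℕ-1
  stirProd≈stirlingChain (a ∷ b ∷ αs)    = ≈-trans (*-congˡ (stirProd≈stirlingChain (b ∷ αs))) (≈-sym (fromℕ-* (stirling1 a b) _))

  -1+-fromℕ : ∀ x g → - 1# + (x + - fromℕ g) ≈ x + - fromℕ (g ℕ.+ 1)
  -1+-fromℕ x g = ≈-trans (solve 3 (λ x g o → (⊝ o ⊕ (x ⊕ ⊝ g)) ⊜ (x ⊕ ⊝ (g ⊕ o))) ≈-refl x (fromℕ g) 1#)
                    (+-congˡ (-‿cong (≈-sym (≈-trans (fromℕ-+ g 1) (+-congˡ fromℕ-1)))))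

  module ℓPower (inv!-inverse : ∀ m → inv! m * fromℕ (m !) ≈ 1#) (N : ℕ) (r : A) where

    Composition : Set
    Composition = Vec ℕ (suc N)

    tailPowers : Composition → Mono
    tailPowers j = zipWith (λ i α → (+ i , - fromℕ α)) (upTo (suc N)) (Vec.toList (tailSums j))

    monoOf : Composition → Mono
    monoOf j = (+ N , r) ∷ tailPowers j

    coefOf : Composition → A
    coefOf j = fromℕ (Vec.last j !) * binom r (Vec.last j) * sign (Vec.head (tailSums j) ℕ.∸ Vec.last (tailSums j))
             * stirProd (Vec.toList (tailSums j))

    termsOf : ℕ → Elem
    termsOf m = concatMap (term N r) (compositions m N)

    rAt : ℕ → A
    rAt t = if N ℕ.≡ᵇ t then r else 0#

    exponentAt : ℕ → Composition → A
    exponentAt i j = expo (monoOf j) (+ i)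

    negatedTails : Composition → List A
    negatedTails j = map (λ α → - fromℕ α) (Vec.toList (tailSums j))

    tailPowers≡run : ∀ j → tailPowers j ≡ run 0 (negatedTails j)
    tailPowers≡run j = zipWith-applyUpTo≡run (λ α → - fromℕ α) (λ t → t) 0 (tailSums j) (λ t → refl)

    expo-tailPowers-+ : ∀ j t → expo (tailPowers j) (+ t) ≈ - fromℕ (entry t (tailSums j))
    expo-tailPowers-+ j t rewrite tailPowers≡run j = ≈-trans (expo-run-+ 0 (negatedTails j) t) (at-negated (tailSums j) t)

    expo-tailPowers-neg : ∀ j m → expo (tailPowers j) -[1+ m ] ≈ 0#
    expo-tailPowers-neg j m rewrite tailPowers≡run j = expo-run-neg 0 (negatedTails j) m

    exponentAt≈ : ∀ i j → exponentAt i j ≈ rAt i + - fromℕ (entry i (tailSums j))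
    exponentAt≈ i j =
      ≈-trans (≈-reflexive (≡.cong (λ b → if b then r + E else E) (isYes≗does (+ N ℤ.≟ + i))))
        (≈-trans (if-+ (N ℕ.≡ᵇ i) r E) (+-congˡ (expo-tailPowers-+ j i)))
      where E = expo (tailPowers j) (+ i)

    exponentAt-≥ : ∀ t j → suc N ℕ.≤ t → exponentAt t j ≈ 0#
    exponentAt-≥ t j N<t = ≈-trans (exponentAt≈ t j)
      (≈-trans (+-cong (≈-reflexive (≡.cong (λ b → if b then r else 0#) (≢⇒≡ᵇ≡false (ℕₚ.<⇒≢ N<t))))
                       (≈-trans (-‿cong (fromℕ-cong (entry-≥ t (tailSums j) N<t))) -0#≈0#))
               (+-identityʳ 0#))

    loweredAt-monoOf : ∀ i j → i ℕ.< suc N → loweredAt (monoOf j) (+ i) ≈ₘ monoOf (incrementAt i j)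
    loweredAt-monoOf i j _ -[1+ m ] =
      ≈-trans (expo-++ (cfactor (+ i)) (monoOf j) -[1+ m ])
        (≈-trans (+-cong (expo-cfactor-neg i m) (expo-tailPowers-neg j m))
          (≈-trans (+-identityˡ 0#) (≈-sym (expo-tailPowers-neg (incrementAt i j) m))))
    loweredAt-monoOf i j i≤N (+ t) =
      ≈-trans (≈-reflexive (≡.cong (λ b → if b then - 1# + X else X) (isYes≗does (+ i ℤ.≟ + t))))
        (≈-trans (if-+ (i ℕ.≡ᵇ t) (- 1#) X)
          (≈-trans (+-congˡ (≈-trans (expo-++ (cfactor (+ i)) (monoOf j) (+ t)) (+-cong (expo-cfactor-+ i t) (exponentAt≈ t j))))
            (≈-trans (shift (ℕₚ.<-cmp t i))
              (≈-sym (≈-trans (exponentAt≈ t (incrementAt i j)) (+-congˡ (-‿cong (fromℕ-cong (entry-tailSums-incrementAt i t j i≤N)))))))))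
      where
      X = expo (cfactor (+ i) ++ monoOf j) (+ t)
      g = entry t (tailSums j)
      shift : Tri (t ℕ.< i) (t ≡ i) (i ℕ.< t) →
        (if i ℕ.≡ᵇ t then - 1# else 0#) + ((if t ℕ.<ᵇ i then - 1# else 0#) + (rAt t + - fromℕ g))
          ≈ rAt t + - fromℕ (g ℕ.+ indicator (t ℕ.≤ᵇ i))
      shift (tri< t<i t≢i _) rewrite ≢⇒≡ᵇ≡false (≡.≢-sym t≢i) | <⇒<ᵇ≡true t<i | ≤⇒≤ᵇ≡true (ℕₚ.<⇒≤ t<i) =
        ≈-trans (+-identityˡ _) (-1+-fromℕ (rAt t) g)
      shift (tri≈ _ refl _) rewrite ≡ᵇ-refl t | ≥⇒<ᵇ≡false (ℕₚ.≤-refl {t}) | ≤⇒≤ᵇ≡true (ℕₚ.≤-refl {t}) =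
        ≈-trans (+-congˡ (+-identityˡ _)) (-1+-fromℕ (rAt t) g)
      shift (tri> _ t≢i i<t)
        rewrite ≢⇒≡ᵇ≡false (≡.≢-sym t≢i) | ≥⇒<ᵇ≡false (ℕₚ.<⇒≤ i<t) | >⇒≤ᵇ≡false i<t | ℕₚ.+-identityʳ g =
        ≈-trans (+-identityˡ _) (+-identityˡ _)

    keyedExponents : Composition → List (A × ℤ)
    keyedExponents j = map (λ i → (exponentAt i j , + i)) (upTo (suc N))

    coefficientOf-keyedExponents : ∀ j k → coefficientOfℤ (asTerms (monoOf j)) k ≈ coefficientOfℤ (keyedExponents j) k
    coefficientOf-keyedExponents j k =
      ≈-trans (coefficientOf-asTerms (monoOf j) k)
        (≈-sym (≈-trans (ℤCollect.coefficientOf≈∑ (keyedExponents j) k)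
                  (≈-trans (≈-reflexive (∑-map (λ i → (exponentAt i j , + i)) (upTo (suc N)) _)) (total k))))
      where
      total : ∀ k → ∑ (upTo (suc N)) (λ i → if does (+ i ℤ.≟ k) then exponentAt i j else 0#) ≈ expo (monoOf j) k
      total -[1+ m ] = ≈-trans (∑-zero (upTo (suc N)) (λ _ → ≈-refl)) (≈-sym (expo-tailPowers-neg j m))
      total (+ t) with ℕₚ.<-≤-connex t (suc N)
      ... | inj₁ t≤N = ≈-trans (∑-δ (suc N) t (λ i → exponentAt i j))
                         (≈-reflexive (≡.cong (λ b → if b then exponentAt t j else 0#) (<⇒<ᵇ≡true t≤N)))
      ... | inj₂ N<t = ≈-trans (∑-δ (suc N) t (λ i → exponentAt i j))
                         (≈-trans (≈-reflexive (≡.cong (λ b → if b then exponentAt t j else 0#) (≥⇒<ᵇ≡false N<t)))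
                                  (≈-sym (exponentAt-≥ t j N<t)))

    dMono-monoOf : ∀ j → dMono (monoOf j) ∼ map (λ i → (exponentAt i j , monoOf (incrementAt i j))) (upTo (suc N))
    dMono-monoOf j =
      ∼-trans (≡⇒∼ (dMono≡embed (monoOf j)))
        (∼-trans (ℤCollect.embed-cong (loweredAt (monoOf j)) (asTerms (monoOf j)) (keyedExponents j) (coefficientOf-keyedExponents j))
          (∼-trans (≡⇒∼ (≡.sym (List.map-∘ (upTo (suc N)))))
            (map-upTo-≈ₘ (suc N) (λ i → exponentAt i j) (λ t t≤N → loweredAt-monoOf t j t≤N))))

    module VCollect = Collect (_≟ᵛ_ {suc N})
    open VCollect using () renaming (coefficientOf to coefficientOfᵛ)

    coefTerms : ℕ → List (A × Composition)
    coefTerms m = map (λ j → (coefOf j , j)) (compositions m N)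

    derivedTerms : ℕ → List (A × Composition)
    derivedTerms m = concatMap (λ j → map (λ i → (coefOf j * exponentAt i j , incrementAt i j)) (upTo (suc N))) (compositions m N)

    termsOf≡embed : ∀ m → termsOf m ≡ VCollect.embed monoOf (coefTerms m)
    termsOf≡embed m = go (compositions m N)
      where
      go : ∀ js → concatMap (term N r) js ≡ VCollect.embed monoOf (map (λ j → (coefOf j , j)) js)
      go []       = refl
      go (j ∷ js) = ≡.cong (_ ∷_) (go js)

    d-termsOf : ∀ m → d (termsOf m) ∼ VCollect.embed monoOf (derivedTerms m)
    d-termsOf m = go (compositions m N)
      where
      derivedOf : Composition → List (A × Composition)
      derivedOf j = map (λ i → (coefOf j * exponentAt i j , incrementAt i j)) (upTo (suc N))
      d-term : ∀ j → d (term N r j) ∼ VCollect.embed monoOf (derivedOf j)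
      d-term j =
        ∼-trans (≡⇒∼ (List.++-identityʳ _))
          (∼-trans (•-congʳ (coefOf j) (dMono-monoOf j))
            (≡⇒∼ (≡.trans (•-map (coefOf j) _ (upTo (suc N))) (List.map-∘ (upTo (suc N))))))
      go : ∀ js → d (concatMap (term N r) js) ∼ VCollect.embed monoOf (concatMap derivedOf js)
      go []       = ∼-refl
      go (j ∷ js) =
        ∼-trans (≡⇒∼ (d-++ (term N r j) (concatMap (term N r) js)))
          (∼-trans (∼-++ (d-term j) (go js)) (≡⇒∼ (≡.sym (List.map-++ (map₂ monoOf) (derivedOf j) (concatMap derivedOf js)))))

    coefficientOf-coefTerms : ∀ m k → coefficientOfᵛ (coefTerms m) k ≈ (if Vec.sum k ℕ.≡ᵇ m then coefOf k else 0#)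
    coefficientOf-coefTerms m k =
      ≈-trans (VCollect.coefficientOf≈∑ (coefTerms m) k)
        (≈-trans (≈-reflexive (∑-map (λ j → (coefOf j , j)) (compositions m N) _)) (∑-compositions-δ N m k coefOf))

    coefficientOf-derivedTerms : ∀ m k → coefficientOfᵛ (derivedTerms m) k ≈
      ∑ (upTo (suc N)) (λ i → if isPositive (entry i k)
                                then (if Vec.sum k ℕ.≡ᵇ suc m then coefOf (decrementAt i k) * exponentAt i (decrementAt i k) else 0#)
                                else 0#)
    coefficientOf-derivedTerms m k =
      ≈-trans (VCollect.coefficientOf≈∑ (derivedTerms m) k)
        (≈-trans (∑-concatMap derivedOf js δₖ)
          (≈-trans (∑-cong js (λ j → ≈-reflexive (∑-map (λ i → (summand i j , incrementAt i j)) (upTo (suc N)) δₖ)))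
            (≈-trans (∑-comm js (upTo (suc N)) (λ j i → if does (incrementAt i j ≟ᵛ k) then summand i j else 0#))
              (∑-upTo-cong (suc N) hit))))
      where
      js = compositions m N
      summand = λ i j → coefOf j * exponentAt i j
      derivedOf = λ j → map (λ i → (summand i j , incrementAt i j)) (upTo (suc N))
      δₖ = λ (p : A × Composition) → if does (proj₂ p ≟ᵛ k) then proj₁ p else 0#
      hit : ∀ i → i ℕ.< suc N → ∑ js (λ j → if does (incrementAt i j ≟ᵛ k) then summand i j else 0#) ≈
        (if isPositive (entry i k) then (if Vec.sum k ℕ.≡ᵇ suc m then summand i (decrementAt i k) else 0#) else 0#)
      hit i i≤N = ≈-trans (∑-cong js (λ j → ≈-reflexive (≡.cong (λ b → if b then summand i j else 0#) (incrementAt-≟ᵛ i j k i≤N))))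
                    (byPositivity (isPositive (entry i k)) refl)
        where
        byPositivity : ∀ b → isPositive (entry i k) ≡ b →
          ∑ js (λ j → if b ∧ does (j ≟ᵛ decrementAt i k) then summand i j else 0#) ≈
            (if b then (if Vec.sum k ℕ.≡ᵇ suc m then summand i (decrementAt i k) else 0#) else 0#)
        byPositivity false _   = ∑-zero js (λ _ → ≈-refl)
        byPositivity true  pos rewrite ≡.sym (sum-decrementAt i k pos) = ∑-compositions-δ N m (decrementAt i k) (summand i)

    fromℕ-!*binom : ∀ n → fromℕ (n !) * binom r n ≈ falling r n
    fromℕ-!*binom n =
      ≈-trans (solve 3 (λ f x i → (f ⊗ (x ⊗ i)) ⊜ (x ⊗ (i ⊗ f))) ≈-refl (fromℕ (n !)) (falling r n) (inv! n))
        (≈-trans (*-congˡ (inv!-inverse n)) (*-identityʳ _))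

    coefOf≈ : ∀ j → coefOf j ≈ falling r (Vec.last j) * (sign (sumExceptLast j) * fromℕ (tailChain j))
    coefOf≈ j = ≈-trans (*-cong (*-cong (fromℕ-!*binom (Vec.last j)) (≈-reflexive (≡.cong sign (head∸last-tailSums j))))
                                (stirProd≈stirlingChain (Vec.toList (tailSums j))))
                        (*-assoc _ _ _)

    summand-< : ∀ i k → i ℕ.< N → isPositive (entry i k) ≡ true →
      coefOf (decrementAt i k) * exponentAt i (decrementAt i k) ≈
        (falling r (Vec.last k) * sign (sumExceptLast k)) * fromℕ (recurrenceFactor i k ℕ.* tailChain (decrementAt i k))
    summand-< i k i<N pos =
      ≈-trans (*-cong (coefOf≈ k') (exponentAt≈ i k'))
        (≈-trans (*-cong (*-congʳ (≈-reflexive (≡.cong (falling r) (last-decrementAt-< i k i<N))))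
                         (+-cong (≈-reflexive (≡.cong (λ b → if b then r else 0#) (≢⇒≡ᵇ≡false (ℕₚ.<⇒≢ i<N ∘′ ≡.sym))))
                                 (-‿cong (fromℕ-cong (entry-tailSums-decrementAt-< i k i<N pos)))))
          (≈-trans (*-congˡ (+-identityˡ _))
            (≈-trans (rearrange (falling r (Vec.last k)) (sign (sumExceptLast k')) (fromℕ (tailChain k')) (fromℕ (recurrenceFactor i k)))
              (*-cong (*-congˡ (≈-trans (≈-sym (-1*x≈-x _)) (≈-reflexive (≡.cong sign (sumExceptLast-decrementAt-< i k i<N pos)))))
                      (≈-sym (fromℕ-* (recurrenceFactor i k) (tailChain k')))))))
      where
      k' = decrementAt i k
      rearrange : ∀ f s p w → (f * (s * p)) * (- w) ≈ (f * (- s)) * (w * p)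
      rearrange f s p w =
        ≈-trans (≈-sym (-‿distribʳ-* _ w))
          (≈-trans (-‿cong (*-Solver.solve 4 (λ f s p w → ((f ∙ (s ∙ p)) ∙ w) *-Solver.⊜ ((f ∙ s) ∙ (w ∙ p))) ≈-refl f s p w))
            (≈-trans (-‿distribˡ-* _ _) (*-congʳ (-‿distribʳ-* f s))))

    summand-last : ∀ k → isPositive (entry N k) ≡ true →
      coefOf (decrementAt N k) * exponentAt N (decrementAt N k) ≈
        (falling r (Vec.last k) * sign (sumExceptLast k)) * fromℕ (recurrenceFactor N k ℕ.* tailChain (decrementAt N k))
    summand-last k pos =
      ≈-trans (*-cong (coefOf≈ k') (exponentAt≈ N k'))
        (≈-trans (*-congˡ (+-cong (≈-reflexive (≡.cong (λ b → if b then r else 0#) (≡ᵇ-refl N)))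
                                  (-‿cong (fromℕ-cong (entry-tailSums-last k')))))
          (≈-trans (*-Solver.solve 4 (λ f s p w → ((f ∙ (s ∙ p)) ∙ w) *-Solver.⊜ (((f ∙ w) ∙ s) ∙ p)) ≈-refl
                     (falling r (Vec.last k')) (sign (sumExceptLast k')) (fromℕ (tailChain k')) (r + - fromℕ (Vec.last k')))
            (*-cong (*-cong (≈-reflexive (≡.cong (falling r) (suc-last-decrementAt-last k pos)))
                            (≈-reflexive (≡.cong sign (sumExceptLast-decrementAt-last k))))
                    (fromℕ-cong (≡.sym (≡.trans (≡.cong (ℕ._* tailChain k') (recurrenceFactor-last k)) (ℕₚ.*-identityˡ _)))))))
      where
      k' = decrementAt N k

    coefOf-recurrence : ∀ k → 1 ℕ.≤ Vec.sum k →
      ∑ (upTo (suc N)) (λ i → if isPositive (entry i k) then coefOf (decrementAt i k) * exponentAt i (decrementAt i k) else 0#) ≈ coefOf k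
    coefOf-recurrence k 1≤sum =
      ≈-trans (∑-upTo-cong (suc N) summand)
        (≈-trans (∑-*ˡ lead (upTo (suc N)) (fromℕ ∘′ recurrenceTerm k))
          (≈-trans (*-congˡ (≈-sym (fromℕ-∑ℕ (upTo (suc N)) (recurrenceTerm k))))
            (≈-trans (*-congˡ (fromℕ-cong (≡.sym (tailChain-recurrence N k 1≤sum))))
              (≈-trans (*-assoc _ _ _) (≈-sym (coefOf≈ k))))))
      where
      lead = falling r (Vec.last k) * sign (sumExceptLast k)
      summand : ∀ i → i ℕ.< suc N →
        (if isPositive (entry i k) then coefOf (decrementAt i k) * exponentAt i (decrementAt i k) else 0#) ≈ lead * fromℕ (recurrenceTerm k i)
      summand i i≤N with isPositive (entry i k) in pos | ℕₚ.m<1+n⇒m<n∨m≡n i≤N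
      ... | false | _           = ≈-sym (zeroʳ lead)
      ... | true  | inj₁ i<N    = summand-< i k i<N pos
      ... | true  | inj₂ refl   = summand-last k pos

    d-termsOf-suc : ∀ m → d (termsOf m) ∼ termsOf (suc m)
    d-termsOf-suc m =
      ∼-trans (d-termsOf m)
        (∼-trans (VCollect.embed-cong monoOf (derivedTerms m) (coefTerms (suc m)) sameCoefficients)
          (≡⇒∼ (≡.sym (termsOf≡embed (suc m)))))
      where
      bySum : ∀ k b → (Vec.sum k ℕ.≡ᵇ suc m) ≡ b →
        ∑ (upTo (suc N)) (λ i → if isPositive (entry i k)
                                  then (if b then coefOf (decrementAt i k) * exponentAt i (decrementAt i k) else 0#)
                                  else 0#)
          ≈ (if b then coefOf k else 0#)
      bySum k false _ = ∑-zero (upTo (suc N)) (λ i → zeroEither (isPositive (entry i k)))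
        where
        zeroEither : ∀ b → (if b then 0# else 0#) ≈ 0#
        zeroEither true  = ≈-refl
        zeroEither false = ≈-refl
      bySum k true sum≡ = coefOf-recurrence k (ℕₚ.≤-trans (ℕ.s≤s ℕ.z≤n) (ℕₚ.≤-reflexive (≡.sym (≡ᵇ≡true⇒≡ sum≡))))
      sameCoefficients : ∀ k → coefficientOfᵛ (derivedTerms m) k ≈ coefficientOfᵛ (coefTerms (suc m)) k
      sameCoefficients k = ≈-trans (coefficientOf-derivedTerms m k)
                             (≈-trans (bySum k _ refl) (≈-sym (coefficientOf-coefTerms (suc m) k)))

    ℓpow∼termsOf-0 : ℓpow (+ N) r ∼ termsOf 0
    ℓpow∼termsOf-0 rewrite compositions-0 N = ∼-trans (∼-coeff _ [] (≈-sym coefOf-0)) (∼-sym (∼-mono _ [] monoOf-0))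
      where
      0s = Vec.replicate (suc N) 0
      coefOf-0 : coefOf 0s ≈ 1#
      coefOf-0 = ≈-trans (coefOf≈ 0s)
        (≈-trans (*-cong (≈-reflexive (≡.cong (falling r) (last-replicate-0 N)))
                         (*-cong (≈-reflexive (≡.cong sign (sumExceptLast-replicate-0 N)))
                                 (fromℕ-cong (tailChain-sum≡0 0s (sum-replicate-0 (suc N))))))
          (≈-trans (*-identityˡ _) (≈-trans (*-identityˡ _) fromℕ-1)))
      monoOf-0 : monoOf 0s ≈ₘ ((+ N , r) ∷ [])
      monoOf-0 = ≈ₘ-∷ (+ N , r) (tailPowers 0s) [] noTail
        where
        noTail : tailPowers 0s ≈ₘ []
        noTail (+ t) = ≈-trans (expo-tailPowers-+ 0s t)
                         (≈-trans (-‿cong (fromℕ-cong (entry-tailSums-sum≡0 t 0s (sum-replicate-0 (suc N))))) -0#≈0#)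
        noTail -[1+ m ] = expo-tailPowers-neg 0s m

    dIter-ℓpow : ∀ m → dIter m (ℓpow (+ N) r) ∼ termsOf m
    dIter-ℓpow zero    = ℓpow∼termsOf-0
    dIter-ℓpow (suc m) = ∼-trans (d-cong (dIter-ℓpow m)) (d-termsOf-suc m)

mainTheorem1 : ∀ {c ℓ} (R : CommutativeRing c ℓ) (inv! : ℕ → CommutativeRing.Carrier R)
                 → (∀ m → CommutativeRing._≈_ R (CommutativeRing._*_ R (inv! m) (Setup.fromℕ R inv! (m !))) (CommutativeRing.1# R))
                 → (N : ℕ) (r : CommutativeRing.Carrier R) (m : ℕ)
                 → Setup._∼_ R inv! (Setup.expYD R inv! (Setup.ℓpow R inv! (+ N) r) m) (Setup.rhs R inv! N r m)
mainTheorem1 R inv! inv!-inverse N r m = •-congʳ (inv! m) (dIter-ℓpow m)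
  where
  open Expansion R inv!
  open ℓPower inv!-inverse N r
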